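{- Let $k,\ell,m$ be positive integers with $\ell\ne m$, and write $q:=2^k$, $Q:=2^\ell$, $R:=2^m$. Let $\omega$ be an element of order $3$ in $\mathbb{F}_{q^2}^*$, and let $\rho(X):=\dfrac{X+\omega}{\omega X+1}\in\mathbb{F}_{q^2}(X)$. Then, as rational functions in $\mathbb{F}_{q^2}(X)$, \[ \left(\frac{X^{Q+R}+X^Q+1}{X^{Q+R}+X^R+1}\right)^{(-1)^m} =\begin{cases} \rho\bigl(\rho(X)^{R-Q}\bigr) &\text{ if $\ell\equiv m\pmod{2}$,} \\ \rho\bigl(\rho(X)^{R+Q}\bigr) &\text{ if $\ell\not\equiv m\pmod{2}$.} \end{cases} \]
   Context: Composition of rational functions is written $(f\circ g)(X)=f(g(X))$; the paper states the identity as $X^{(-1)^m}\circ\frac{X^{Q+R}+X^Q+1}{X^{Q+R}+X^R+1}=\rho\circ X^{R\mp Q}\circ\rho$. Note that $R-Q$ may be negative, in which case $\rho(X)^{R-Q}$ denotes the corresponding negative power of the rational function $\rho(X)$. Since $q^2=4^k$, the field $\mathbb{F}_{q^2}$ contains an element of order $3$. -}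

module Defs where

open import Level using (Level; _⊔_; suc)
open import Algebra.Bundles using (CommutativeRing)
open import Data.Nat as ℕ using (ℕ; zero)
open import Data.Integer as ℤ using (ℤ; +_; -[1+_])
open import Data.Fin using (Fin)
open import Data.List using (List; []; _∷_; map)
open import Data.Product using (_×_; Σ)
open import Data.Unit.Polymorphic using (⊤)
open import Relation.Nullary using (¬_)
open import Function.Bundles using (Inverse)
import Relation.Binary.PropositionalEquality as P

record Field (c ℓ : Level) : Set (suc (c ⊔ ℓ)) where
  field
    commutativeRing : CommutativeRing c ℓ
  open CommutativeRing commutativeRing public
  field
    1≉0     : ¬ (1# ≈ 0#)
    inverse : ∀ x → ¬ (x ≈ 0#) → Σ Carrier (λ y → x * y ≈ 1#)

module _ {c ℓ : Level} (F : Field c ℓ) where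
  open Field F

  HasCard : ℕ → Set (c ⊔ ℓ)
  HasCard n = Inverse (P.setoid (Fin n)) setoid

  pow : Carrier → ℕ → Carrier
  pow x zero      = 1#
  pow x (ℕ.suc n) = x * pow x n

  HasOrder : Carrier → ℕ → Set ℓ
  HasOrder x n = (ℕ.NonZero n) × (pow x n ≈ 1#)
               × (∀ j → 0 ℕ.< j → j ℕ.< n → ¬ (pow x j ≈ 1#))

  -- Polynomials F[X] : coefficient lists, constant term first.
  Poly : Set c
  Poly = List Carrier

  -- equality of polynomials: coefficientwise, up to trailing zeros
  _≈ₚ_ : Poly → Poly → Set ℓ
  []      ≈ₚ []      = ⊤
  []      ≈ₚ (b ∷ q) = (b ≈ 0#) × ([] ≈ₚ q)
  (a ∷ p) ≈ₚ []      = (a ≈ 0#) × (p ≈ₚ [])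
  (a ∷ p) ≈ₚ (b ∷ q) = (a ≈ b) × (p ≈ₚ q)

  _+ₚ_ : Poly → Poly → Poly
  []      +ₚ q       = q
  (a ∷ p) +ₚ []      = a ∷ p
  (a ∷ p) +ₚ (b ∷ q) = (a + b) ∷ (p +ₚ q)

  _*ₚ_ : Poly → Poly → Poly
  []      *ₚ q = []
  (a ∷ p) *ₚ q = map (a *_) q +ₚ (0# ∷ (p *ₚ q))

  constₚ : Carrier → Poly
  constₚ a = a ∷ []

  Xₚ : Poly
  Xₚ = 0# ∷ 1# ∷ []

  _^ₚ_ : Poly → ℕ → Poly
  p ^ₚ zero      = constₚ 1#
  p ^ₚ ℕ.suc n   = p *ₚ (p ^ₚ n)

  record RatFun : Set c where
    constructor _//_
    field
      num : Poly
      den : Poly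
  open RatFun public

  _≈ᵣ_ : RatFun → RatFun → Set ℓ
  f ≈ᵣ g = ¬ (den f ≈ₚ []) × ¬ (den g ≈ₚ [])
         × ((num f *ₚ den g) ≈ₚ (num g *ₚ den f))

  _+ᵣ_ : RatFun → RatFun → RatFun
  (a // b) +ᵣ (c' // d) = ((a *ₚ d) +ₚ (c' *ₚ b)) // (b *ₚ d)

  _*ᵣ_ : RatFun → RatFun → RatFun
  (a // b) *ᵣ (c' // d) = (a *ₚ c') // (b *ₚ d)

  -- division (meaningful when the divisor is nonzero)
  _/ᵣ_ : RatFun → RatFun → RatFun
  (a // b) /ᵣ (c' // d) = (a *ₚ d) // (b *ₚ c')

  constᵣ : Carrier → RatFun
  constᵣ a = constₚ a // constₚ 1#

  Xᵣ : RatFun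
  Xᵣ = Xₚ // constₚ 1#

  _^ᵣ_ : RatFun → ℤ → RatFun
  (a // b) ^ᵣ (+ n)      = (a ^ₚ n) // (b ^ₚ n)
  (a // b) ^ᵣ -[1+ n ]   = (b ^ₚ ℕ.suc n) // (a ^ₚ ℕ.suc n)

  ρ : Carrier → RatFun → RatFun
  ρ ω y = (y +ᵣ constᵣ ω) /ᵣ ((constᵣ ω *ᵣ y) +ᵣ constᵣ 1#)

  frac : ℕ → ℕ → RatFun
  frac Q R = (((Xᵣ ^ᵣ (+ (Q ℕ.+ R))) +ᵣ (Xᵣ ^ᵣ (+ Q))) +ᵣ constᵣ 1#)
          /ᵣ (((Xᵣ ^ᵣ (+ (Q ℕ.+ R))) +ᵣ (Xᵣ ^ᵣ (+ R))) +ᵣ constᵣ 1#)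

{-# OPTIONS --safe #-}
-- In characteristic two the Frobenius map gives ρ(X)^(2^n) = ρ̂(X^(2^n)), where ρ̂(A) = (A + ω)/(ω A + 1),
-- when n is even; when n is odd ω^(2^n) = ω² and (A + ω²)/(ω² A + 1) = ρ̂(A)⁻¹. So with A = X^Q and
-- B = X^R, in both parity cases the argument of the outer ρ is ρ̂(B)/ρ̂(A) if m is even and its inverse
-- if m is odd. Because ω + ω² = 1 and ω³ = 1, expanding gives ρ(ρ̂(B)/ρ̂(A)) = (AB + A + 1)/(AB + B + 1)
-- on the nose, and ρ commutes with y ↦ 1/y. (F has characteristic two because it has 4^k elements.)
module Submission where

open import Defs
open import Level using (Level)
open import Data.Nat as ℕ using (ℕ)
open import Data.Integer as ℤ using (ℤ; +_; -1ℤ)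
open import Data.Product using (_×_)
open import Relation.Nullary using (¬_)
open import Relation.Binary.PropositionalEquality using (_≡_; _≢_)

open import Level using (_⊔_)
open import Algebra.Bundles using (CommutativeRing)
open import Algebra.Structures using (IsCommutativeRing)
import Algebra.Consequences.Setoid as Consequences
open import Data.Nat using (zero; suc; s≤s; z≤n; _%_)
import Data.Nat.Properties as ℕ
open import Data.Integer using (-[1+_]; _⊖_)
open import Data.Integer.Properties using ([1+m]⊖[1+n]≡m⊖n; [+m]-[+n]≡m⊖n)
open import Data.Fin using (Fin)
import Data.Fin.Properties as Fin
open import Data.Fin.Permutation using (Permutation; permutation)
open import Data.List using ([]; _∷_; map)
open import Data.Product using (_,_; proj₁; proj₂)
open import Data.Sum using (_⊎_; inj₁; inj₂; reduce)
open import Data.Unit.Polymorphic using (tt)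
open import Data.Empty using (⊥-elim)
open import Function.Bundles using (Inverse)
open import Relation.Nullary using (yes; no)
open import Relation.Binary.Bundles using (Setoid)
open import Relation.Binary.Structures using (IsEquivalence)
open import Relation.Binary.Definitions using (Decidable)
import Relation.Binary.PropositionalEquality as ≡
import Relation.Binary.Reasoning.Setoid as SetoidReasoning

module FieldProperties {c ℓ : Level} (F : Field c ℓ) where
  open Field F
  open SetoidReasoning setoid
  open import Algebra.Solver.Ring.NaturalCoefficients.Default commutativeSemiring
  import Algebra.Properties.Semiring.Mult semiring as Mult
  open Mult using (×1-homo-*)

  x*y≈0⇒x≈0 : ∀ {x y} → ¬ (y ≈ 0#) → x * y ≈ 0# → x ≈ 0#
  x*y≈0⇒x≈0 {x} {y} y≉0 xy≈0 = begin
    x              ≈⟨ *-identityʳ x ⟨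
    x * 1#         ≈⟨ *-congˡ (proj₂ (inverse y y≉0)) ⟨
    x * (y * y⁻¹)  ≈⟨ *-assoc x y y⁻¹ ⟨
    (x * y) * y⁻¹  ≈⟨ *-congʳ xy≈0 ⟩
    0# * y⁻¹       ≈⟨ zeroˡ y⁻¹ ⟩
    0#             ∎
    where
    y⁻¹ : Carrier
    y⁻¹ = proj₁ (inverse y y≉0)

  x*y≉0 : ∀ {x y} → ¬ (x ≈ 0#) → ¬ (y ≈ 0#) → ¬ (x * y ≈ 0#)
  x*y≉0 x≉0 y≉0 xy≈0 = x≉0 (x*y≈0⇒x≈0 y≉0 xy≈0)

  -- In characteristic two (ω + ω² + 1)(ω + 1) = ω³ + 1 = 0, and ω + 1 ≉ 0 because ω ≉ 1.
  hasOrder3⇒ω+ω²≈1 : (1# + 1# ≈ 0#) → ∀ {ω} → HasOrder F ω 3 → ω + ω * ω ≈ 1#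
  hasOrder3⇒ω+ω²≈1 1+1≈0 {ω} (_ , ω³≈1 , minimal) = begin
    ω + ω * ω                   ≈⟨ +-identityʳ _ ⟨
    ω + ω * ω + 0#              ≈⟨ +-congˡ 1+1≈0 ⟨
    ω + ω * ω + (1# + 1#)       ≈⟨ regroup ω ⟩
    (ω + ω * ω + 1#) + 1#       ≈⟨ +-congʳ (x*y≈0⇒x≈0 ω+1≉0 φ[ω]*[ω+1]≈0) ⟩
    0# + 1#                     ≈⟨ +-identityˡ 1# ⟩
    1#                          ∎
    where
    regroup : ∀ x → x + x * x + (1# + 1#) ≈ (x + x * x + 1#) + 1#
    regroup = solve 1 (λ x → x :+ x :* x :+ (con 1 :+ con 1) := (x :+ x :* x :+ con 1) :+ con 1) refl
    cube : ∀ x → (x + x * x + 1#) * (x + 1#) ≈ x * (x * (x * 1#)) + 1# + (1# + 1#) * (x + x * x)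
    cube = solve 1 (λ x → (x :+ x :* x :+ con 1) :* (x :+ con 1)
                          := x :* (x :* (x :* con 1)) :+ con 1 :+ (con 1 :+ con 1) :* (x :+ x :* x)) refl
    φ[ω]*[ω+1]≈0 : (ω + ω * ω + 1#) * (ω + 1#) ≈ 0#
    φ[ω]*[ω+1]≈0 = begin
      (ω + ω * ω + 1#) * (ω + 1#)                        ≈⟨ cube ω ⟩
      ω * (ω * (ω * 1#)) + 1# + (1# + 1#) * (ω + ω * ω)  ≈⟨ +-cong (+-congʳ ω³≈1) (*-congʳ 1+1≈0) ⟩
      1# + 1# + 0# * (ω + ω * ω)                         ≈⟨ +-cong 1+1≈0 (zeroˡ _) ⟩
      0# + 0#                                            ≈⟨ +-identityˡ 0# ⟩
      0#                                                 ∎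
    ω+1≉0 : ¬ (ω + 1# ≈ 0#)
    ω+1≉0 ω+1≈0 = minimal 1 (s≤s z≤n) (s≤s (s≤s z≤n)) (begin
      ω * 1#              ≈⟨ *-identityʳ ω ⟩
      ω                   ≈⟨ +-identityʳ ω ⟨
      ω + 0#              ≈⟨ +-congˡ 1+1≈0 ⟨
      ω + (1# + 1#)       ≈⟨ +-assoc ω 1# 1# ⟨
      (ω + 1#) + 1#       ≈⟨ +-congʳ ω+1≈0 ⟩
      0# + 1#             ≈⟨ +-identityˡ 1# ⟩
      1#                  ∎)

  module FiniteField {n : ℕ} (card : HasCard F n) where
    open Inverse card
    open import Algebra.Properties.CommutativeMonoid.Sum +-commutativeMonoid
    open import Algebra.Properties.Group +-group using (identityʳ-unique)

    _≟_ : Decidable _≈_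
    x ≟ y with from x Fin.≟ from y
    ... | yes fx≡fy = yes (begin
      x            ≈⟨ strictlyInverseˡ x ⟨
      to (from x)  ≡⟨ ≡.cong to fx≡fy ⟩
      to (from y)  ≈⟨ strictlyInverseˡ y ⟩
      y            ∎)
    ... | no fx≢fy = no (λ x≈y → fx≢fy (from-cong x≈y))

    x*y≈0⇒x≈0⊎y≈0 : ∀ {x y} → x * y ≈ 0# → x ≈ 0# ⊎ y ≈ 0#
    x*y≈0⇒x≈0⊎y≈0 {x} {y} xy≈0 with y ≟ 0#
    ... | yes y≈0 = inj₂ y≈0
    ... | no  y≉0 = inj₁ (x*y≈0⇒x≈0 y≉0 xy≈0)

    -- Translation by 1 permutes the field, so Σ x = Σ (x + 1) = Σ x + n × 1.
    card×1≈0 : n Mult.× 1# ≈ 0#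
    card×1≈0 = identityʳ-unique (sum to) (n Mult.× 1#) (sym (begin
      sum to                              ≈⟨ sum-permute to translation ⟩
      sum (λ i → to (from (to i + 1#)))   ≈⟨ sum-cong-≋ (λ i → strictlyInverseˡ (to i + 1#)) ⟩
      sum {n} (λ i → to i + 1#)           ≈⟨ ∑-distrib-+ to (λ _ → 1#) ⟩
      sum to + sum {n} (λ _ → 1#)         ≈⟨ +-congˡ (sum-replicate n) ⟩
      sum to + n Mult.× 1#                ∎))
      where
      translation : Permutation n n
      translation = permutation (λ i → from (to i + 1#)) (λ i → from (to i - 1#))
        (λ i → ≡.trans (from-cong (translate-back i (-‿inverseˡ 1#))) (strictlyInverseʳ i))
        (λ i → ≡.trans (from-cong (translate-back i (-‿inverseʳ 1#))) (strictlyInverseʳ i))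
        where
        translate-back : ∀ i {a b} → a + b ≈ 0# → to (from (to i + a)) + b ≈ to i
        translate-back i {a} {b} a+b≈0 = begin
          to (from (to i + a)) + b  ≈⟨ +-congʳ (strictlyInverseˡ (to i + a)) ⟩
          (to i + a) + b            ≈⟨ +-assoc (to i) a b ⟩
          to i + (a + b)            ≈⟨ +-congˡ a+b≈0 ⟩
          to i + 0#                 ≈⟨ +-identityʳ (to i) ⟩
          to i                      ∎

    2^k×1≈0⇒1+1≈0 : ∀ k → (2 ℕ.^ k) Mult.× 1# ≈ 0# → 1# + 1# ≈ 0#
    2^k×1≈0⇒1+1≈0 zero    1+0≈0 = ⊥-elim (1≉0 (trans (sym (+-identityʳ 1#)) 1+0≈0))
    2^k×1≈0⇒1+1≈0 (suc k) 2^[1+k]×1≈0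
      with x*y≈0⇒x≈0⊎y≈0 (trans (sym (×1-homo-* 2 (2 ℕ.^ k))) 2^[1+k]×1≈0)
    ... | inj₁ 1+[1+0]≈0 = trans (+-congˡ (sym (+-identityʳ 1#))) 1+[1+0]≈0
    ... | inj₂ 2^k×1≈0   = 2^k×1≈0⇒1+1≈0 k 2^k×1≈0

  characteristic-two : ∀ k → HasCard F (2 ℕ.^ k ℕ.* 2 ℕ.^ k) → 1# + 1# ≈ 0#
  characteristic-two k card =
    2^k×1≈0⇒1+1≈0 k (reduce (x*y≈0⇒x≈0⊎y≈0 (trans (sym (×1-homo-* 2^k 2^k)) card×1≈0)))
    where
    open FiniteField card
    2^k : ℕ
    2^k = 2 ℕ.^ k

module CommutativeRingFacts {c ℓ : Level} (R : CommutativeRing c ℓ) where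
  open CommutativeRing R
  open SetoidReasoning setoid
  open import Algebra.Properties.Semiring.Exp semiring using (_^_; ^-congˡ; ^-congʳ; ^-assocʳ)
  open import Algebra.Solver.Ring.NaturalCoefficients.Default commutativeSemiring

  module CharacteristicTwo (1+1≈0 : 1# + 1# ≈ 0#) where

    [1+1]*x≈0 : ∀ x → (1# + 1#) * x ≈ 0#
    [1+1]*x≈0 x = trans (*-congʳ 1+1≈0) (zeroˡ x)

    square-+ : ∀ x y → (x + y) ^ 2 ≈ x ^ 2 + y ^ 2
    square-+ x y = begin
      (x + y) ^ 2                           ≈⟨ expand x y ⟩
      x ^ 2 + y ^ 2 + (1# + 1#) * (x * y)   ≈⟨ +-congˡ ([1+1]*x≈0 (x * y)) ⟩
      x ^ 2 + y ^ 2 + 0#                    ≈⟨ +-identityʳ _ ⟩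
      x ^ 2 + y ^ 2                         ∎
      where
      expand : ∀ x y → (x + y) ^ 2 ≈ x ^ 2 + y ^ 2 + (1# + 1#) * (x * y)
      expand = solve 2 (λ x y → (x :+ y) :* ((x :+ y) :* con 1)
                             := x :* (x :* con 1) :+ y :* (y :* con 1) :+ (con 1 :+ con 1) :* (x :* y)) refl

    frobenius : ∀ n x y → (x + y) ^ (2 ℕ.^ n) ≈ x ^ (2 ℕ.^ n) + y ^ (2 ℕ.^ n)
    frobenius zero    x y = trans (*-identityʳ (x + y)) (+-cong (sym (*-identityʳ x)) (sym (*-identityʳ y)))
    frobenius (suc n) x y = begin
      (x + y) ^ (2 ℕ.* 2^n)              ≈⟨ ^-assocʳ (x + y) 2 2^n ⟨
      ((x + y) ^ 2) ^ 2^n                ≈⟨ ^-congˡ 2^n (square-+ x y) ⟩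
      (x ^ 2 + y ^ 2) ^ 2^n              ≈⟨ frobenius n (x ^ 2) (y ^ 2) ⟩
      (x ^ 2) ^ 2^n + (y ^ 2) ^ 2^n      ≈⟨ +-cong (^-assocʳ x 2 2^n) (^-assocʳ y 2 2^n) ⟩
      x ^ (2 ℕ.* 2^n) + y ^ (2 ℕ.* 2^n)  ∎
      where
      2^n : ℕ
      2^n = 2 ℕ.^ n

    module CubeRootOfUnity (w : Carrier) (w+w²≈1 : w + w * w ≈ 1#) (w³≈1 : w ^ 3 ≈ 1#) where

      w^[2^[2+n]]≈w^[2^n] : ∀ n → w ^ (2 ℕ.^ (2 ℕ.+ n)) ≈ w ^ (2 ℕ.^ n)
      w^[2^[2+n]]≈w^[2^n] n = begin
        w ^ (2 ℕ.* (2 ℕ.* 2 ℕ.^ n))  ≈⟨ ^-congʳ w (ℕ.*-assoc 2 2 (2 ℕ.^ n)) ⟨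
        w ^ (4 ℕ.* 2 ℕ.^ n)          ≈⟨ ^-assocʳ w 4 (2 ℕ.^ n) ⟨
        (w ^ 4) ^ (2 ℕ.^ n)          ≈⟨ ^-congˡ (2 ℕ.^ n) (trans (*-congˡ w³≈1) (*-identityʳ w)) ⟩
        w ^ (2 ℕ.^ n)                ∎

      w^[2^even]≈w : ∀ n → n % 2 ≡ 0 → w ^ (2 ℕ.^ n) ≈ w
      w^[2^even]≈w zero          _    = *-identityʳ w
      w^[2^even]≈w (suc (suc n)) even = trans (w^[2^[2+n]]≈w^[2^n] n) (w^[2^even]≈w n even)

      w^[2^odd]≈w² : ∀ n → n % 2 ≡ 1 → w ^ (2 ℕ.^ n) ≈ w * w
      w^[2^odd]≈w² (suc zero)    _   = *-congˡ (*-identityʳ w)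
      w^[2^odd]≈w² (suc (suc n)) odd = trans (w^[2^[2+n]]≈w^[2^n] n) (w^[2^odd]≈w² n odd)

      w²*[w*x+1]≈x+w² : ∀ x → (w * w) * (w * x + 1#) ≈ x + w * w
      w²*[w*x+1]≈x+w² x = begin
        (w * w) * (w * x + 1#)  ≈⟨ expand w x ⟩
        w ^ 3 * x + w * w       ≈⟨ +-congʳ (trans (*-congʳ w³≈1) (*-identityˡ x)) ⟩
        x + w * w               ∎
        where
        expand : ∀ w x → (w * w) * (w * x + 1#) ≈ w ^ 3 * x + w * w
        expand = solve 2 (λ w x → (w :* w) :* (w :* x :+ con 1)
                               := w :* (w :* (w :* con 1)) :* x :+ w :* w) refl

      w²*[x+w]≈w²*x+1 : ∀ x → (w * w) * (x + w) ≈ (w * w) * x + 1#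
      w²*[x+w]≈w²*x+1 x = begin
        (w * w) * (x + w)      ≈⟨ expand w x ⟩
        (w * w) * x + w ^ 3    ≈⟨ +-congˡ w³≈1 ⟩
        (w * w) * x + 1#       ∎
        where
        expand : ∀ w x → (w * w) * (x + w) ≈ (w * w) * x + w ^ 3
        expand = solve 2 (λ w x → (w :* w) :* (x :+ w) := (w :* w) :* x :+ w :* (w :* (w :* con 1))) refl

      private
        collapse : ∀ P x → (w + w * w) * P + (1# + w ^ 3) * x ≈ P
        collapse P x = begin
          (w + w * w) * P + (1# + w ^ 3) * x  ≈⟨ +-cong (*-congʳ w+w²≈1) (*-congʳ (+-congˡ w³≈1)) ⟩
          1# * P + (1# + 1#) * x              ≈⟨ +-cong (*-identityˡ P) ([1+1]*x≈0 x) ⟩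
          P + 0#                              ≈⟨ +-identityʳ P ⟩
          P                                   ∎

      -- Numerator and denominator of ρ(ρ̂(B)/ρ̂(A)) after removing the factor (w B + 1)(A + w),
      -- for ρ(y) = (y + w)/(w y + 1) and ρ̂(A) = (A + w)/(w A + 1).
      möbius-quotient-num : ∀ A B →
        (B + w) * (w * A + 1#) + w * ((w * B + 1#) * (A + w)) ≈ A * B + A + 1#
      möbius-quotient-num A B = trans (expand w A B) (collapse (A * B + A + 1#) B)
        where
        expand : ∀ w A B → (B + w) * (w * A + 1#) + w * ((w * B + 1#) * (A + w))
                           ≈ (w + w * w) * (A * B + A + 1#) + (1# + w ^ 3) * B
        expand = solve 3 (λ w A B → (B :+ w) :* (w :* A :+ con 1) :+ w :* ((w :* B :+ con 1) :* (A :+ w))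
                 := (w :+ w :* w) :* (A :* B :+ A :+ con 1) :+ (con 1 :+ w :* (w :* (w :* con 1))) :* B) refl

      möbius-quotient-den : ∀ A B →
        w * ((B + w) * (w * A + 1#)) + (w * B + 1#) * (A + w) ≈ A * B + B + 1#
      möbius-quotient-den A B = trans (expand w A B) (collapse (A * B + B + 1#) A)
        where
        expand : ∀ w A B → w * ((B + w) * (w * A + 1#)) + (w * B + 1#) * (A + w)
                           ≈ (w + w * w) * (A * B + B + 1#) + (1# + w ^ 3) * A
        expand = solve 3 (λ w A B → w :* ((B :+ w) :* (w :* A :+ con 1)) :+ (w :* B :+ con 1) :* (A :+ w)
                 := (w :+ w :* w) :* (A :* B :+ B :+ con 1) :+ (con 1 :+ w :* (w :* (w :* con 1))) :* A) refl

module Polynomial {c ℓ : Level} (F : Field c ℓ) where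
  open Field F
  open import Algebra.Properties.Ring ring using (-0#≈0#)
  open FieldProperties F using (x*y≈0⇒x≈0)

  infix  4 _≋_
  infixl 6 _⊕_
  infixl 7 _⊛_

  _⊕_ _⊛_ : Poly F → Poly F → Poly F
  _⊕_ = _+ₚ_ F
  _⊛_ = _*ₚ_ F

  ⊝_ : Poly F → Poly F
  ⊝_ = map (-_)

  _·_ : Carrier → Poly F → Poly F
  a · p = map (a *_) p

  -- A record wrapper, so that both sides can be inferred from an equation.
  record _≋_ (p q : Poly F) : Set ℓ where
    constructor lift
    field lower : _≈ₚ_ F p q
  open _≋_ public

  ∷-cong : ∀ {a b p q} → a ≈ b → p ≋ q → a ∷ p ≋ b ∷ q
  ∷-cong a≈b (lift p≈q) = lift (a≈b , p≈q)

  ∷-≋[] : ∀ {a p} → a ≈ 0# → p ≋ [] → a ∷ p ≋ []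
  ∷-≋[] a≈0 (lift p≈[]) = lift (a≈0 , p≈[])

  []≋-∷ : ∀ {b q} → b ≈ 0# → [] ≋ q → [] ≋ b ∷ q
  []≋-∷ b≈0 (lift []≈q) = lift (b≈0 , []≈q)

  ≋-refl : ∀ {p} → p ≋ p
  ≋-refl {[]}    = lift tt
  ≋-refl {a ∷ p} = ∷-cong refl ≋-refl

  ≋-sym : ∀ {p q} → p ≋ q → q ≋ p
  ≋-sym {[]}    {[]}    e                = e
  ≋-sym {[]}    {b ∷ q} (lift (b≈0 , e)) = ∷-≋[] b≈0 (≋-sym {[]} {q} (lift e))
  ≋-sym {a ∷ p} {[]}    (lift (a≈0 , e)) = []≋-∷ a≈0 (≋-sym {p} {[]} (lift e))
  ≋-sym {a ∷ p} {b ∷ q} (lift (a≈b , e)) = ∷-cong (sym a≈b) (≋-sym {p} {q} (lift e))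

  ≋-trans : ∀ {p q r} → p ≋ q → q ≋ r → p ≋ r
  ≋-trans {[]} {[]} e e′ = e′
  ≋-trans {[]} {b ∷ q} {[]} e e′ = lift tt
  ≋-trans {[]} {b ∷ q} {d ∷ r} (lift (b≈0 , e)) (lift (b≈d , e′)) =
    []≋-∷ (trans (sym b≈d) b≈0) (≋-trans {[]} {q} {r} (lift e) (lift e′))
  ≋-trans {a ∷ p} {[]} {[]} e e′ = e
  ≋-trans {a ∷ p} {[]} {d ∷ r} (lift (a≈0 , e)) (lift (d≈0 , e′)) =
    ∷-cong (trans a≈0 (sym d≈0)) (≋-trans {p} {[]} {r} (lift e) (lift e′))
  ≋-trans {a ∷ p} {b ∷ q} {[]} (lift (a≈b , e)) (lift (b≈0 , e′)) =
    ∷-≋[] (trans a≈b b≈0) (≋-trans {p} {q} {[]} (lift e) (lift e′))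
  ≋-trans {a ∷ p} {b ∷ q} {d ∷ r} (lift (a≈b , e)) (lift (b≈d , e′)) =
    ∷-cong (trans a≈b b≈d) (≋-trans {p} {q} {r} (lift e) (lift e′))

  ⊕-identityʳ : ∀ p → p ⊕ [] ≋ p
  ⊕-identityʳ []      = ≋-refl
  ⊕-identityʳ (a ∷ p) = ≋-refl

  ⊕-comm : ∀ p q → p ⊕ q ≋ q ⊕ p
  ⊕-comm []      q       = ≋-sym (⊕-identityʳ q)
  ⊕-comm (a ∷ p) []      = ≋-refl
  ⊕-comm (a ∷ p) (b ∷ q) = ∷-cong (+-comm a b) (⊕-comm p q)

  ⊕-assoc : ∀ p q r → (p ⊕ q) ⊕ r ≋ p ⊕ (q ⊕ r)
  ⊕-assoc []      q       r       = ≋-refl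
  ⊕-assoc (a ∷ p) []      r       = ≋-refl
  ⊕-assoc (a ∷ p) (b ∷ q) []      = ≋-refl
  ⊕-assoc (a ∷ p) (b ∷ q) (d ∷ r) = ∷-cong (+-assoc a b d) (⊕-assoc p q r)

  ⊕-congˡ : ∀ p {q q′} → q ≋ q′ → p ⊕ q ≋ p ⊕ q′
  ⊕-congˡ []      e = e
  ⊕-congˡ (a ∷ p) {[]}    {[]}    e = ≋-refl
  ⊕-congˡ (a ∷ p) {[]}    {d ∷ r} (lift (d≈0 , e)) =
    ∷-cong (trans (sym (+-identityʳ a)) (+-congˡ (sym d≈0)))
           (≋-trans (≋-sym (⊕-identityʳ p)) (⊕-congˡ p {[]} {r} (lift e)))
  ⊕-congˡ (a ∷ p) {b ∷ q} {[]}    (lift (b≈0 , e)) =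
    ∷-cong (trans (+-congˡ b≈0) (+-identityʳ a))
           (≋-trans (⊕-congˡ p {q} {[]} (lift e)) (⊕-identityʳ p))
  ⊕-congˡ (a ∷ p) {b ∷ q} {d ∷ r} (lift (b≈d , e)) =
    ∷-cong (+-congˡ b≈d) (⊕-congˡ p {q} {r} (lift e))

  ⊕-inverseʳ : ∀ p → p ⊕ ⊝ p ≋ []
  ⊕-inverseʳ []      = ≋-refl
  ⊕-inverseʳ (a ∷ p) = ∷-≋[] (-‿inverseʳ a) (⊕-inverseʳ p)

  ⊝-cong : ∀ {p q} → p ≋ q → ⊝ p ≋ ⊝ q
  ⊝-cong {[]}    {[]}    e = e
  ⊝-cong {[]}    {b ∷ q} (lift (b≈0 , e)) =
    []≋-∷ (trans (-‿cong b≈0) -0#≈0#) (⊝-cong {[]} {q} (lift e))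
  ⊝-cong {a ∷ p} {[]}    (lift (a≈0 , e)) =
    ∷-≋[] (trans (-‿cong a≈0) -0#≈0#) (⊝-cong {p} {[]} (lift e))
  ⊝-cong {a ∷ p} {b ∷ q} (lift (a≈b , e)) = ∷-cong (-‿cong a≈b) (⊝-cong {p} {q} (lift e))

  ≋-isEquivalence : IsEquivalence _≋_
  ≋-isEquivalence = record { refl = ≋-refl ; sym = ≋-sym ; trans = ≋-trans }

  ≋-setoid : Setoid c ℓ
  ≋-setoid = record { isEquivalence = ≋-isEquivalence }

  open SetoidReasoning ≋-setoid
  open Consequences ≋-setoid
    using (comm∧assoc⇒middleFour; comm∧invʳ⇒inv; comm∧idˡ⇒id; comm∧distrʳ⇒distr)

  ⊕-cong : ∀ {p p′ q q′} → p ≋ p′ → q ≋ q′ → p ⊕ q ≋ p′ ⊕ q′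
  ⊕-cong {p} {p′} {q} {q′} p≈p′ q≈q′ = begin
    p ⊕ q   ≈⟨ ⊕-congˡ p q≈q′ ⟩
    p ⊕ q′  ≈⟨ ⊕-comm p q′ ⟩
    q′ ⊕ p  ≈⟨ ⊕-congˡ q′ p≈p′ ⟩
    q′ ⊕ p′ ≈⟨ ⊕-comm q′ p′ ⟩
    p′ ⊕ q′ ∎

  ⊕-middleFour : ∀ p q r s → (p ⊕ q) ⊕ (r ⊕ s) ≋ (p ⊕ r) ⊕ (q ⊕ s)
  ⊕-middleFour = comm∧assoc⇒middleFour ⊕-cong ⊕-comm ⊕-assoc

  ·-congˡ : ∀ a {p q} → p ≋ q → a · p ≋ a · q
  ·-congˡ a {[]}    {[]}    e = e
  ·-congˡ a {[]}    {b ∷ q} (lift (b≈0 , e)) =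
    []≋-∷ (trans (*-congˡ b≈0) (zeroʳ a)) (·-congˡ a {[]} {q} (lift e))
  ·-congˡ a {d ∷ p} {[]}    (lift (d≈0 , e)) =
    ∷-≋[] (trans (*-congˡ d≈0) (zeroʳ a)) (·-congˡ a {p} {[]} (lift e))
  ·-congˡ a {d ∷ p} {b ∷ q} (lift (d≈b , e)) = ∷-cong (*-congˡ d≈b) (·-congˡ a {p} {q} (lift e))

  ·-congʳ : ∀ {a b} p → a ≈ b → a · p ≋ b · p
  ·-congʳ []      a≈b = ≋-refl
  ·-congʳ (d ∷ p) a≈b = ∷-cong (*-congʳ a≈b) (·-congʳ p a≈b)

  ·-zeroˡ : ∀ p → 0# · p ≋ []
  ·-zeroˡ []      = ≋-refl
  ·-zeroˡ (d ∷ p) = ∷-≋[] (zeroˡ d) (·-zeroˡ p)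

  ·-distribˡ : ∀ a p q → a · (p ⊕ q) ≋ a · p ⊕ a · q
  ·-distribˡ a []      q       = ≋-refl
  ·-distribˡ a (d ∷ p) []      = ≋-refl
  ·-distribˡ a (d ∷ p) (e ∷ q) = ∷-cong (distribˡ a d e) (·-distribˡ a p q)

  ·-distribʳ : ∀ a b p → (a + b) · p ≋ a · p ⊕ b · p
  ·-distribʳ a b []      = ≋-refl
  ·-distribʳ a b (d ∷ p) = ∷-cong (distribʳ d a b) (·-distribʳ a b p)

  ·-assoc : ∀ a b p → a · (b · p) ≋ (a * b) · p
  ·-assoc a b []      = ≋-refl
  ·-assoc a b (d ∷ p) = ∷-cong (sym (*-assoc a b d)) (·-assoc a b p)

  ·-identityˡ : ∀ p → 1# · p ≋ p
  ·-identityˡ []      = ≋-refl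
  ·-identityˡ (d ∷ p) = ∷-cong (*-identityˡ d) (·-identityˡ p)

  ⊛-zeroʳ : ∀ p → p ⊛ [] ≋ []
  ⊛-zeroʳ []      = ≋-refl
  ⊛-zeroʳ (a ∷ p) = ∷-≋[] refl (⊛-zeroʳ p)

  ⊛-annihilatedˡ : ∀ {p} q → p ≋ [] → p ⊛ q ≋ []
  ⊛-annihilatedˡ {[]}    q _                = ≋-refl
  ⊛-annihilatedˡ {a ∷ p} q (lift (a≈0 , e)) = begin
    a · q ⊕ (0# ∷ p ⊛ q) ≈⟨ ⊕-cong (≋-trans (·-congʳ q a≈0) (·-zeroˡ q))
                                   (∷-≋[] refl (⊛-annihilatedˡ {p} q (lift e))) ⟩
    [] ⊕ []              ≈⟨ ≋-refl ⟩
    []                   ∎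

  ⊛-congʳ : ∀ {p p′} q → p ≋ p′ → p ⊛ q ≋ p′ ⊛ q
  ⊛-congʳ {[]}    {[]}     q e = ≋-refl
  ⊛-congʳ {[]}    {b ∷ p′} q e = ≋-sym (⊛-annihilatedˡ q (≋-sym e))
  ⊛-congʳ {a ∷ p} {[]}     q e = ⊛-annihilatedˡ q e
  ⊛-congʳ {a ∷ p} {b ∷ p′} q (lift (a≈b , e)) =
    ⊕-cong (·-congʳ q a≈b) (∷-cong refl (⊛-congʳ {p} {p′} q (lift e)))

  ⊛-congˡ : ∀ p {q q′} → q ≋ q′ → p ⊛ q ≋ p ⊛ q′
  ⊛-congˡ []      e = ≋-refl
  ⊛-congˡ (a ∷ p) e = ⊕-cong (·-congˡ a e) (∷-cong refl (⊛-congˡ p e))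

  ⊕-leftCommute : ∀ p q r → p ⊕ (q ⊕ r) ≋ q ⊕ (p ⊕ r)
  ⊕-leftCommute p q r = begin
    p ⊕ (q ⊕ r) ≈⟨ ≋-sym (⊕-assoc p q r) ⟩
    (p ⊕ q) ⊕ r ≈⟨ ⊕-cong (⊕-comm p q) ≋-refl ⟩
    (q ⊕ p) ⊕ r ≈⟨ ⊕-assoc q p r ⟩
    q ⊕ (p ⊕ r) ∎

  ⊛-shiftʳ : ∀ p b q → p ⊛ (b ∷ q) ≋ b · p ⊕ (0# ∷ p ⊛ q)
  ⊛-shiftʳ []      b q = ≋-sym (∷-≋[] refl ≋-refl)
  ⊛-shiftʳ (a ∷ p) b q = ∷-cong (+-congʳ (*-comm a b)) (begin
    a · q ⊕ p ⊛ (b ∷ q)                ≈⟨ ⊕-congˡ (a · q) (⊛-shiftʳ p b q) ⟩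
    a · q ⊕ (b · p ⊕ (0# ∷ p ⊛ q))     ≈⟨ ⊕-leftCommute (a · q) (b · p) _ ⟩
    b · p ⊕ (a · q ⊕ (0# ∷ p ⊛ q))     ∎)

  ⊛-shiftˡ : ∀ p q → (0# ∷ p) ⊛ q ≋ 0# ∷ p ⊛ q
  ⊛-shiftˡ p q = ⊕-cong (·-zeroˡ q) ≋-refl

  ⊛-comm : ∀ p q → p ⊛ q ≋ q ⊛ p
  ⊛-comm []      q = ≋-sym (⊛-zeroʳ q)
  ⊛-comm (a ∷ p) q = begin
    a · q ⊕ (0# ∷ p ⊛ q) ≈⟨ ⊕-congˡ (a · q) (∷-cong refl (⊛-comm p q)) ⟩
    a · q ⊕ (0# ∷ q ⊛ p) ≈⟨ ≋-sym (⊛-shiftʳ q a p) ⟩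
    q ⊛ (a ∷ p)          ∎

  ⊛-distribʳ : ∀ r p q → (p ⊕ q) ⊛ r ≋ p ⊛ r ⊕ q ⊛ r
  ⊛-distribʳ r []      q       = ≋-refl
  ⊛-distribʳ r (a ∷ p) []      = ≋-sym (⊕-identityʳ _)
  ⊛-distribʳ r (a ∷ p) (b ∷ q) = begin
    (a + b) · r ⊕ (0# ∷ (p ⊕ q) ⊛ r)
      ≈⟨ ⊕-cong (·-distribʳ a b r) (∷-cong (sym (+-identityʳ 0#)) (⊛-distribʳ r p q)) ⟩
    (a · r ⊕ b · r) ⊕ ((0# ∷ p ⊛ r) ⊕ (0# ∷ q ⊛ r))
      ≈⟨ ⊕-middleFour (a · r) (b · r) _ _ ⟩
    (a · r ⊕ (0# ∷ p ⊛ r)) ⊕ (b · r ⊕ (0# ∷ q ⊛ r))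
      ∎

  ·-⊛ : ∀ a q r → (a · q) ⊛ r ≋ a · (q ⊛ r)
  ·-⊛ a []      r = ≋-refl
  ·-⊛ a (b ∷ q) r = begin
    (a * b) · r ⊕ (0# ∷ (a · q) ⊛ r)
      ≈⟨ ⊕-cong (≋-sym (·-assoc a b r)) (∷-cong (sym (zeroʳ a)) (·-⊛ a q r)) ⟩
    a · (b · r) ⊕ a · (0# ∷ q ⊛ r)    ≈⟨ ≋-sym (·-distribˡ a (b · r) _) ⟩
    a · (b · r ⊕ (0# ∷ q ⊛ r))        ∎

  ⊛-assoc : ∀ p q r → (p ⊛ q) ⊛ r ≋ p ⊛ (q ⊛ r)
  ⊛-assoc []      q r = ≋-refl
  ⊛-assoc (a ∷ p) q r = begin
    (a · q ⊕ (0# ∷ p ⊛ q)) ⊛ r        ≈⟨ ⊛-distribʳ r (a · q) _ ⟩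
    (a · q) ⊛ r ⊕ (0# ∷ p ⊛ q) ⊛ r    ≈⟨ ⊕-cong (·-⊛ a q r) (⊛-shiftˡ (p ⊛ q) r) ⟩
    a · (q ⊛ r) ⊕ (0# ∷ (p ⊛ q) ⊛ r)  ≈⟨ ⊕-congˡ (a · (q ⊛ r)) (∷-cong refl (⊛-assoc p q r)) ⟩
    a · (q ⊛ r) ⊕ (0# ∷ p ⊛ (q ⊛ r))  ∎

  ⊛-identityˡ : ∀ p → constₚ F 1# ⊛ p ≋ p
  ⊛-identityˡ p = begin
    1# · p ⊕ (0# ∷ [])  ≈⟨ ⊕-cong (·-identityˡ p) (∷-≋[] refl ≋-refl) ⟩
    p ⊕ []              ≈⟨ ⊕-identityʳ p ⟩
    p                   ∎

  ⊕-⊛-isCommutativeRing : IsCommutativeRing _≋_ _⊕_ _⊛_ ⊝_ [] (constₚ F 1#)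
  ⊕-⊛-isCommutativeRing = record
    { isRing = record
      { +-isAbelianGroup = record
        { isGroup = record
          { isMonoid = record
            { isSemigroup = record
              { isMagma = record { isEquivalence = ≋-isEquivalence ; ∙-cong = ⊕-cong }
              ; assoc = ⊕-assoc
              }
            ; identity = (λ _ → ≋-refl) , ⊕-identityʳ
            }
          ; inverse = comm∧invʳ⇒inv ⊕-comm ⊕-inverseʳ
          ; ⁻¹-cong = ⊝-cong
          }
        ; comm = ⊕-comm
        }
      ; *-cong = λ {_} {p′} {q} p≈p′ q≈q′ → ≋-trans (⊛-congʳ q p≈p′) (⊛-congˡ p′ q≈q′)
      ; *-assoc = ⊛-assoc
      ; *-identity = comm∧idˡ⇒id ⊛-comm ⊛-identityˡ
      ; distrib = comm∧distrʳ⇒distr ⊕-cong ⊛-comm ⊛-distribʳ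
      }
    ; *-comm = ⊛-comm
    }

  F[X] : CommutativeRing c ℓ
  F[X] = record { isCommutativeRing = ⊕-⊛-isCommutativeRing }

  coeff₀ : Poly F → Carrier
  coeff₀ []      = 0#
  coeff₀ (a ∷ _) = a

  coeff₀-cong : ∀ {p q} → p ≋ q → coeff₀ p ≈ coeff₀ q
  coeff₀-cong {[]}    {[]}    _                = refl
  coeff₀-cong {[]}    {b ∷ q} (lift (b≈0 , _)) = sym b≈0
  coeff₀-cong {a ∷ p} {[]}    (lift (a≈0 , _)) = a≈0
  coeff₀-cong {a ∷ p} {b ∷ q} (lift (a≈b , _)) = a≈b

  coeff₀-⊕ : ∀ p q → coeff₀ (p ⊕ q) ≈ coeff₀ p + coeff₀ q
  coeff₀-⊕ []      q       = sym (+-identityˡ _)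
  coeff₀-⊕ (a ∷ p) []      = sym (+-identityʳ a)
  coeff₀-⊕ (a ∷ p) (b ∷ q) = refl

  coeff₀-· : ∀ a q → coeff₀ (a · q) ≈ a * coeff₀ q
  coeff₀-· a []      = sym (zeroʳ a)
  coeff₀-· a (b ∷ q) = refl

  coeff₀-⊛ : ∀ p q → coeff₀ (p ⊛ q) ≈ coeff₀ p * coeff₀ q
  coeff₀-⊛ []      q = sym (zeroˡ _)
  coeff₀-⊛ (a ∷ p) q = trans (coeff₀-⊕ (a · q) _) (trans (+-identityʳ _) (coeff₀-· a q))

  record NonVanishing (p : Poly F) : Set ℓ where
    constructor nonVanishing
    field coeff₀≉0 : ¬ (coeff₀ p ≈ 0#)
  open NonVanishing public

  p⊛q≋[]⇒p≋[] : ∀ p {q} → NonVanishing q → p ⊛ q ≋ [] → p ≋ []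
  p⊛q≋[]⇒p≋[] []      _    _     = ≋-refl
  p⊛q≋[]⇒p≋[] (a ∷ p) {q} q-nv@(nonVanishing q₀≉0) pq≈0 =
    ∷-≋[] a≈0 (p⊛q≋[]⇒p≋[] p q-nv (lift (proj₂ (lower tail≈0))))
    where
    a≈0 : a ≈ 0#
    a≈0 = x*y≈0⇒x≈0 q₀≉0 (trans (sym (coeff₀-⊛ (a ∷ p) q)) (coeff₀-cong pq≈0))
    tail≈0 : 0# ∷ p ⊛ q ≋ []
    tail≈0 = begin
      0# ∷ p ⊛ q            ≈⟨ ⊕-cong (≋-sym (≋-trans (·-congʳ q a≈0) (·-zeroˡ q))) ≋-refl ⟩
      a · q ⊕ (0# ∷ p ⊛ q)  ≈⟨ pq≈0 ⟩
      []                    ∎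

n%2≡0⊎n%2≡1 : ∀ n → n % 2 ≡ 0 ⊎ n % 2 ≡ 1
n%2≡0⊎n%2≡1 zero          = inj₁ ≡.refl
n%2≡0⊎n%2≡1 (suc zero)    = inj₂ ≡.refl
n%2≡0⊎n%2≡1 (suc (suc n)) = n%2≡0⊎n%2≡1 n

-1^even≡1 : ∀ n → n % 2 ≡ 0 → -1ℤ ℤ.^ n ≡ + 1
-1^even≡1 zero          _    = ≡.refl
-1^even≡1 (suc (suc n)) even = ≡.cong (λ i → -1ℤ ℤ.* (-1ℤ ℤ.* i)) (-1^even≡1 n even)

-1^odd≡-1 : ∀ n → n % 2 ≡ 1 → -1ℤ ℤ.^ n ≡ -1ℤ
-1^odd≡-1 (suc zero)    _   = ≡.refl
-1^odd≡-1 (suc (suc n)) odd = ≡.cong (λ i → -1ℤ ℤ.* (-1ℤ ℤ.* i)) (-1^odd≡-1 n odd)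

module RationalFunctions {c ℓ : Level} (F : Field c ℓ) where
  module K = Field F
  open Polynomial F
    using (F[X]; lift; lower; coeff₀; coeff₀-cong; coeff₀-⊕; coeff₀-⊛; NonVanishing; nonVanishing; p⊛q≋[]⇒p≋[])
  open CommutativeRing F[X]
  open SetoidReasoning setoid
  open import Algebra.Properties.Semiring.Exp semiring using (_^_; ^-congˡ; ^-homo-*)
  open import Algebra.Properties.CommutativeSemiring.Exp commutativeSemiring using (^-distrib-*)
  open import Algebra.Properties.CommutativeSemigroup *-commutativeSemigroup using (interchange; x∙yz≈y∙xz)
  open import Algebra.Properties.Ring ring using (-‿distribˡ-*)
  open FieldProperties F using (x*y≉0; hasOrder3⇒ω+ω²≈1)

  X : Poly F
  X = Xₚ F

  nonVanishing-resp : ∀ {p q} → p ≈ q → NonVanishing p → NonVanishing q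
  nonVanishing-resp p≈q (nonVanishing p₀≉0) =
    nonVanishing (λ q₀≈0 → p₀≉0 (K.trans (coeff₀-cong p≈q) q₀≈0))

  nonVanishing-* : ∀ {p q} → NonVanishing p → NonVanishing q → NonVanishing (p * q)
  nonVanishing-* {p} {q} (nonVanishing p₀≉0) (nonVanishing q₀≉0) =
    nonVanishing (λ pq₀≈0 → x*y≉0 p₀≉0 q₀≉0 (K.trans (K.sym (coeff₀-⊛ p q)) pq₀≈0))

  nonVanishing-*⁻ʳ : ∀ {p q} → NonVanishing (p * q) → NonVanishing q
  nonVanishing-*⁻ʳ {p} {q} (nonVanishing pq₀≉0) =
    nonVanishing (λ q₀≈0 → pq₀≉0 (K.trans (coeff₀-⊛ p q) (K.trans (K.*-congˡ q₀≈0) (K.zeroʳ _))))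

  nonVanishing-1 : NonVanishing 1#
  nonVanishing-1 = nonVanishing K.1≉0

  nonVanishing-^ : ∀ {p} n → NonVanishing p → NonVanishing (p ^ n)
  nonVanishing-^ zero    _  = nonVanishing-1
  nonVanishing-^ (suc n) nv = nonVanishing-* nv (nonVanishing-^ n nv)

  *-cancelʳ-nonVanishing : ∀ {p q r} → NonVanishing r → p * r ≈ q * r → p ≈ q
  *-cancelʳ-nonVanishing {p} {q} {r} r₀≉0 pr≈qr = begin
    p              ≈⟨ +-identityʳ p ⟨
    p + 0#         ≈⟨ +-congˡ (-‿inverseˡ q) ⟨
    p + (- q + q)  ≈⟨ +-assoc p (- q) q ⟨
    (p - q) + q    ≈⟨ +-congʳ p-q≈0 ⟩
    0# + q         ≈⟨ +-identityˡ q ⟩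
    q              ∎
    where
    p-q≈0 : p - q ≈ 0#
    p-q≈0 = p⊛q≋[]⇒p≋[] (p - q) r₀≉0 (begin
      (p - q) * r        ≈⟨ distribʳ r p (- q) ⟩
      p * r + - q * r    ≈⟨ +-cong pr≈qr (sym (-‿distribˡ-* q r)) ⟩
      q * r - q * r      ≈⟨ -‿inverseʳ (q * r) ⟩
      0#                 ∎)

  infix 4 _≐_ _∝_

  _≐_ : RatFun F → RatFun F → Set ℓ
  f ≐ g = num f ≈ num g × den f ≈ den g

  -- Numerators and denominators agree up to factors that do not vanish at 0;
  -- unlike cross-multiplication, this is transitive without cancelling.
  record _∝_ (f g : RatFun F) : Set (c ⊔ ℓ) where
    field
      κ κ′         : Poly F
      κ-nonVanishing  : NonVanishing κ
      κ′-nonVanishing : NonVanishing κ′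
      num-∝        : κ * num f ≈ κ′ * num g
      den-∝        : κ * den f ≈ κ′ * den g
  open _∝_

  private
    rescale-trans : ∀ a b c d x y z → a * x ≈ b * y → c * y ≈ d * z → (c * a) * x ≈ (b * d) * z
    rescale-trans a b c d x y z ax≈by cy≈dz = begin
      (c * a) * x  ≈⟨ *-assoc c a x ⟩
      c * (a * x)  ≈⟨ *-congˡ {c} ax≈by ⟩
      c * (b * y)  ≈⟨ x∙yz≈y∙xz c b y ⟩
      b * (c * y)  ≈⟨ *-congˡ {b} cy≈dz ⟩
      b * (d * z)  ≈⟨ *-assoc b d z ⟨
      (b * d) * z  ∎

    rescale-+ : ∀ a b x y u v → a * x ≈ b * y → a * u ≈ b * v → a * (x + u) ≈ b * (y + v)
    rescale-+ a b x y u v ax≈by au≈bv =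
      trans (distribˡ a x u) (trans (+-cong ax≈by au≈bv) (sym (distribˡ b y v)))

    rescale-scalar : ∀ a b s x y → a * x ≈ b * y → a * (s * x) ≈ b * (s * y)
    rescale-scalar a b s x y ax≈by =
      trans (x∙yz≈y∙xz a s x) (trans (*-congˡ {s} ax≈by) (x∙yz≈y∙xz s b y))

    rescale-* : ∀ a b c d x y u v → a * x ≈ b * y → c * u ≈ d * v → (a * c) * (x * u) ≈ (b * d) * (y * v)
    rescale-* a b c d x y u v ax≈by cu≈dv = begin
      (a * c) * (x * u)  ≈⟨ interchange a c x u ⟩
      (a * x) * (c * u)  ≈⟨ *-cong ax≈by cu≈dv ⟩
      (b * y) * (d * v)  ≈⟨ interchange b y d v ⟩
      (b * d) * (y * v)  ∎

  ≐⇒∝ : ∀ {f g} → f ≐ g → f ∝ g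
  ≐⇒∝ (num≈ , den≈) = record
    { κ = 1# ; κ′ = 1# ; κ-nonVanishing = nonVanishing-1 ; κ′-nonVanishing = nonVanishing-1
    ; num-∝ = *-congˡ {1#} num≈ ; den-∝ = *-congˡ {1#} den≈ }

  ∝-sym : ∀ {f g} → f ∝ g → g ∝ f
  ∝-sym f∝g = record
    { κ = κ′ f∝g ; κ′ = κ f∝g
    ; κ-nonVanishing = κ′-nonVanishing f∝g ; κ′-nonVanishing = κ-nonVanishing f∝g
    ; num-∝ = sym (num-∝ f∝g) ; den-∝ = sym (den-∝ f∝g) }

  ∝-trans : ∀ {f g h} → f ∝ g → g ∝ h → f ∝ h
  ∝-trans {f} {g} {h} f∝g g∝h = record
    { κ = κ₂ * κ₁ ; κ′ = κ₁′ * κ₂′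
    ; κ-nonVanishing = nonVanishing-* (κ-nonVanishing g∝h) (κ-nonVanishing f∝g)
    ; κ′-nonVanishing = nonVanishing-* (κ′-nonVanishing f∝g) (κ′-nonVanishing g∝h)
    ; num-∝ = rescale-trans κ₁ κ₁′ κ₂ κ₂′ (num f) (num g) (num h) (num-∝ f∝g) (num-∝ g∝h)
    ; den-∝ = rescale-trans κ₁ κ₁′ κ₂ κ₂′ (den f) (den g) (den h) (den-∝ f∝g) (den-∝ g∝h) }
    where
    κ₁ κ₁′ κ₂ κ₂′ : Poly F
    κ₁ = κ f∝g; κ₁′ = κ′ f∝g; κ₂ = κ g∝h; κ₂′ = κ′ g∝h

  ∝-rescale : ∀ {a b} m → NonVanishing m → (a // b) ∝ ((m * a) // (m * b))
  ∝-rescale m m-nv = record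
    { κ = m ; κ′ = 1# ; κ-nonVanishing = m-nv ; κ′-nonVanishing = nonVanishing-1
    ; num-∝ = sym (*-identityˡ _) ; den-∝ = sym (*-identityˡ _) }

  inv : RatFun F → RatFun F
  inv f = den f // num f

  inv-cong : ∀ {f g} → f ∝ g → inv f ∝ inv g
  inv-cong f∝g = record
    { κ = κ f∝g ; κ′ = κ′ f∝g
    ; κ-nonVanishing = κ-nonVanishing f∝g ; κ′-nonVanishing = κ′-nonVanishing f∝g
    ; num-∝ = den-∝ f∝g ; den-∝ = num-∝ f∝g }

  *ᵣ-cong : ∀ {f f′ g g′} → f ∝ f′ → g ∝ g′ → _*ᵣ_ F f g ∝ _*ᵣ_ F f′ g′
  *ᵣ-cong {f} {f′} {g} {g′} f∝f′ g∝g′ = record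
    { κ = κ₁ * κ₂ ; κ′ = κ₁′ * κ₂′
    ; κ-nonVanishing = nonVanishing-* (κ-nonVanishing f∝f′) (κ-nonVanishing g∝g′)
    ; κ′-nonVanishing = nonVanishing-* (κ′-nonVanishing f∝f′) (κ′-nonVanishing g∝g′)
    ; num-∝ = rescale-* κ₁ κ₁′ κ₂ κ₂′ (num f) (num f′) (num g) (num g′)
                        (num-∝ f∝f′) (num-∝ g∝g′)
    ; den-∝ = rescale-* κ₁ κ₁′ κ₂ κ₂′ (den f) (den f′) (den g) (den g′)
                        (den-∝ f∝f′) (den-∝ g∝g′) }
    where
    κ₁ κ₁′ κ₂ κ₂′ : Poly F
    κ₁ = κ f∝f′; κ₁′ = κ′ f∝f′; κ₂ = κ g∝g′; κ₂′ = κ′ g∝g′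

  /ᵣ-cong : ∀ {f f′ g g′} → f ∝ f′ → g ∝ g′ → _/ᵣ_ F f g ∝ _/ᵣ_ F f′ g′
  /ᵣ-cong f∝f′ g∝g′ = *ᵣ-cong f∝f′ (inv-cong g∝g′)

  ^ₚ≈^ : ∀ p n → _^ₚ_ F p n ≈ p ^ n
  ^ₚ≈^ p zero    = refl
  ^ₚ≈^ p (suc n) = *-congˡ {p} (^ₚ≈^ p n)

  ^ᵣ-cong : ∀ {f g} n → f ∝ g → _^ᵣ_ F f (+ n) ∝ _^ᵣ_ F g (+ n)
  ^ᵣ-cong {f} {g} n f∝g = record
    { κ = κ f∝g ^ n ; κ′ = κ′ f∝g ^ n
    ; κ-nonVanishing = nonVanishing-^ n (κ-nonVanishing f∝g)
    ; κ′-nonVanishing = nonVanishing-^ n (κ′-nonVanishing f∝g)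
    ; num-∝ = rescale-^ (num f) (num g) (num-∝ f∝g)
    ; den-∝ = rescale-^ (den f) (den g) (den-∝ f∝g) }
    where
    rescale-^ : ∀ x y → κ f∝g * x ≈ κ′ f∝g * y → κ f∝g ^ n * _^ₚ_ F x n ≈ κ′ f∝g ^ n * _^ₚ_ F y n
    rescale-^ x y κx≈κ′y = begin
      κ f∝g ^ n * _^ₚ_ F x n   ≈⟨ *-congˡ {κ f∝g ^ n} (^ₚ≈^ x n) ⟩
      κ f∝g ^ n * x ^ n        ≈⟨ ^-distrib-* (κ f∝g) x n ⟨
      (κ f∝g * x) ^ n          ≈⟨ ^-congˡ n κx≈κ′y ⟩
      (κ′ f∝g * y) ^ n         ≈⟨ ^-distrib-* (κ′ f∝g) y n ⟩
      κ′ f∝g ^ n * y ^ n       ≈⟨ *-congˡ {κ′ f∝g ^ n} (^ₚ≈^ y n) ⟨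
      κ′ f∝g ^ n * _^ₚ_ F y n  ∎

  ^ᵣ-homo-+ : ∀ f m n → _^ᵣ_ F f (+ m ℤ.+ + n) ∝ _*ᵣ_ F (_^ᵣ_ F f (+ m)) (_^ᵣ_ F f (+ n))
  ^ᵣ-homo-+ f m n = ≐⇒∝ (homo (num f) , homo (den f))
    where
    homo : ∀ p → _^ₚ_ F p (m ℕ.+ n) ≈ _^ₚ_ F p m * _^ₚ_ F p n
    homo p = begin
      _^ₚ_ F p (m ℕ.+ n)         ≈⟨ ^ₚ≈^ p (m ℕ.+ n) ⟩
      p ^ (m ℕ.+ n)              ≈⟨ ^-homo-* p m n ⟩
      p ^ m * p ^ n              ≈⟨ *-cong (^ₚ≈^ p m) (^ₚ≈^ p n) ⟨
      _^ₚ_ F p m * _^ₚ_ F p n    ∎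

  ^ᵣ-homo-⊖ : ∀ {f} → NonVanishing (num f) → NonVanishing (den f) →
              ∀ m n → _^ᵣ_ F f (m ⊖ n) ∝ _/ᵣ_ F (_^ᵣ_ F f (+ m)) (_^ᵣ_ F f (+ n))
  ^ᵣ-homo-⊖ _ _ m zero = ≐⇒∝ (sym (*-identityʳ _) , sym (*-identityʳ _))
  ^ᵣ-homo-⊖ _ _ zero (suc n) = ≐⇒∝ (sym (*-identityˡ _) , sym (*-identityˡ _))
  ^ᵣ-homo-⊖ {f} a-nv b-nv (suc m) (suc n) rewrite [1+m]⊖[1+n]≡m⊖n m n =
    ∝-trans (^ᵣ-homo-⊖ a-nv b-nv m n) (∝-trans (∝-rescale (a * b) (nonVanishing-* a-nv b-nv))
      (≐⇒∝ (shift a b m n , trans (*-congʳ (*-comm a b)) (shift b a m n))))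
    where
    a b : Poly F
    a = num f
    b = den f
    shift : ∀ x y i j → (x * y) * (_^ₚ_ F x i * _^ₚ_ F y j) ≈ _^ₚ_ F x (suc i) * _^ₚ_ F y (suc j)
    shift x y i j = interchange x y (_^ₚ_ F x i) (_^ₚ_ F y j)

  ^ᵣ-cong-ℤ : ∀ {f g} i → f ∝ g → _^ᵣ_ F f i ∝ _^ᵣ_ F g i
  ^ᵣ-cong-ℤ (+ n)      f∝g = ^ᵣ-cong n f∝g
  ^ᵣ-cong-ℤ -[1+ n ]   f∝g = inv-cong (^ᵣ-cong (suc n) f∝g)

  1^n≈1 : ∀ n → 1# ^ n ≈ 1#
  1^n≈1 zero    = refl
  1^n≈1 (suc n) = trans (*-identityˡ _) (1^n≈1 n)

  poly : Poly F → RatFun F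
  poly p = p // 1#

  Xᵣ^≐ : ∀ n → _^ᵣ_ F (Xᵣ F) (+ n) ≐ poly (X ^ n)
  Xᵣ^≐ n = ^ₚ≈^ X n , trans (^ₚ≈^ 1# n) (1^n≈1 n)

  +ᵣ-poly : ∀ {f g p q} → f ≐ poly p → g ≐ poly q → _+ᵣ_ F f g ≐ poly (p + q)
  +ᵣ-poly {p = p} {q} (nf≈p , df≈1) (ng≈q , dg≈1) =
    +-cong (trans (*-cong nf≈p dg≈1) (*-identityʳ p)) (trans (*-cong ng≈q df≈1) (*-identityʳ q)) ,
    trans (*-cong df≈1 dg≈1) (*-identityʳ 1#)

  /ᵣ-poly : ∀ {f g p q} → f ≐ poly p → g ≐ poly q → _/ᵣ_ F f g ≐ (p // q)
  /ᵣ-poly {p = p} {q} (nf≈p , df≈1) (ng≈q , dg≈1) =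
    trans (*-cong nf≈p dg≈1) (*-identityʳ p) , trans (*-cong df≈1 ng≈q) (*-identityˡ q)

  fracₚ : Poly F → Poly F → RatFun F
  fracₚ A B = (A * B + A + 1#) // (A * B + B + 1#)

  frac≐ : ∀ Q R → frac F Q R ≐ fracₚ (X ^ Q) (X ^ R)
  frac≐ Q R = /ᵣ-poly (+ᵣ-poly (+ᵣ-poly X^[Q+R] (Xᵣ^≐ Q)) (refl , refl))
                      (+ᵣ-poly (+ᵣ-poly X^[Q+R] (Xᵣ^≐ R)) (refl , refl))
    where
    X^[Q+R] : _^ᵣ_ F (Xᵣ F) (+ (Q ℕ.+ R)) ≐ poly (X ^ Q * X ^ R)
    X^[Q+R] = trans (proj₁ (Xᵣ^≐ (Q ℕ.+ R))) (^-homo-* X Q R) , proj₂ (Xᵣ^≐ (Q ℕ.+ R))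

  vanishing-X^ : ∀ n .{{_ : ℕ.NonZero n}} → coeff₀ (X ^ n) K.≈ K.0#
  vanishing-X^ (suc n) = K.trans (coeff₀-⊛ X (X ^ n)) (K.zeroˡ _)

  vanishing-*ʳ : ∀ p q → coeff₀ q K.≈ K.0# → coeff₀ (p * q) K.≈ K.0#
  vanishing-*ʳ p q q₀≈0 = K.trans (coeff₀-⊛ p q) (K.trans (K.*-congˡ q₀≈0) (K.zeroʳ _))

  vanishing-+ : ∀ p q → coeff₀ p K.≈ K.0# → coeff₀ q K.≈ K.0# → coeff₀ (p + q) K.≈ K.0#
  vanishing-+ p q p₀≈0 q₀≈0 =
    K.trans (coeff₀-⊕ p q) (K.trans (K.+-cong p₀≈0 q₀≈0) (K.+-identityʳ K.0#))

  nonVanishing-vanishing+ : ∀ {p q} → coeff₀ p K.≈ K.0# → NonVanishing q → NonVanishing (p + q)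
  nonVanishing-vanishing+ {p} {q} p₀≈0 (nonVanishing q₀≉0) = nonVanishing λ [p+q]₀≈0 →
    q₀≉0 (K.trans (K.sym (K.trans (K.+-congʳ p₀≈0) (K.+-identityˡ _)))
                  (K.trans (K.sym (coeff₀-⊕ p q)) [p+q]₀≈0))

  ∝⇒≈ᵣ : ∀ {f g h} → f ∝ h → g ∝ h → NonVanishing (den h) → _≈ᵣ_ F f g
  ∝⇒≈ᵣ {f} {g} {h} f∝h g∝h dh-nv =
    nonZero (den-nonVanishing f∝h) , nonZero (den-nonVanishing g∝h) , lower cross
    where
    nonZero : ∀ {p} → NonVanishing p → ¬ (_≈ₚ_ F p [])
    nonZero (nonVanishing p₀≉0) p≈0 = p₀≉0 (coeff₀-cong (lift p≈0))
    den-nonVanishing : ∀ {e} → e ∝ h → NonVanishing (den e)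
    den-nonVanishing e∝h = nonVanishing-*⁻ʳ {κ e∝h} (nonVanishing-resp (sym (den-∝ e∝h))
                             (nonVanishing-* (κ′-nonVanishing e∝h) dh-nv))
    cross : num f * den g ≈ num g * den f
    cross = *-cancelʳ-nonVanishing (nonVanishing-* (κ-nonVanishing f∝h) (κ-nonVanishing g∝h)) (begin
      (num f * den g) * (a * b)    ≈⟨ pull (num f) (den g) a b ⟩
      (a * num f) * (b * den g)    ≈⟨ *-cong (num-∝ f∝h) (den-∝ g∝h) ⟩
      (a′ * num h) * (b′ * den h)  ≈⟨ swap a′ (num h) b′ (den h) ⟩
      (b′ * num h) * (a′ * den h)  ≈⟨ *-cong (num-∝ g∝h) (den-∝ f∝h) ⟨
      (b * num g) * (a * den f)    ≈⟨ swap b (num g) a (den f) ⟩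
      (a * num g) * (b * den f)    ≈⟨ pull (num g) (den f) a b ⟨
      (num g * den f) * (a * b)    ∎)
      where
      a a′ b b′ : Poly F
      a = κ f∝h; a′ = κ′ f∝h; b = κ g∝h; b′ = κ′ g∝h
      pull : ∀ x y c d → (x * y) * (c * d) ≈ (c * x) * (d * y)
      pull x y c d = trans (interchange x y c d) (*-cong (*-comm x c) (*-comm y d))
      swap : ∀ c x d y → (c * x) * (d * y) ≈ (d * x) * (c * y)
      swap c x d y = trans (interchange c x d y) (trans (*-congʳ (*-comm c d)) (interchange d c x y))

  frac^[-1^even] : ∀ Q R m → m % 2 ≡ 0 → _^ᵣ_ F (frac F Q R) (-1ℤ ℤ.^ m) ∝ fracₚ (X ^ Q) (X ^ R)
  frac^[-1^even] Q R m even rewrite -1^even≡1 m even =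
    ≐⇒∝ (trans (*-identityʳ _) (proj₁ (frac≐ Q R)) , trans (*-identityʳ _) (proj₂ (frac≐ Q R)))

  frac^[-1^odd] : ∀ Q R m → m % 2 ≡ 1 → _^ᵣ_ F (frac F Q R) (-1ℤ ℤ.^ m) ∝ inv (fracₚ (X ^ Q) (X ^ R))
  frac^[-1^odd] Q R m odd rewrite -1^odd≡-1 m odd =
    ≐⇒∝ (trans (*-identityʳ _) (proj₂ (frac≐ Q R)) , trans (*-identityʳ _) (proj₁ (frac≐ Q R)))

  module Möbius {ω : K.Carrier} (1+1≈0 : K.1# K.+ K.1# K.≈ K.0#) (ω-order : HasOrder F ω 3) where

    w : Poly F
    w = constₚ F ω

    private
      const-* : ∀ a b → constₚ F a * constₚ F b ≈ constₚ F (a K.* b)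
      const-* a b = lift (K.+-identityʳ _ , tt)

      1+1≈0ₚ : 1# + 1# ≈ 0#
      1+1≈0ₚ = lift (1+1≈0 , tt)

      w+w²≈1 : w + w * w ≈ 1#
      w+w²≈1 = trans (+-congˡ {w} (const-* ω ω)) (lift (hasOrder3⇒ω+ω²≈1 1+1≈0 ω-order , tt))

      w³≈1 : w ^ 3 ≈ 1#
      w³≈1 = trans (*-congˡ {w} (trans (*-congˡ {w} (const-* ω K.1#)) (const-* ω _)))
                   (trans (const-* ω _) (lift (proj₁ (proj₂ ω-order) , tt)))

    open CommutativeRingFacts.CharacteristicTwo F[X] 1+1≈0ₚ using (frobenius)
    open CommutativeRingFacts.CharacteristicTwo.CubeRootOfUnity F[X] 1+1≈0ₚ w w+w²≈1 w³≈1

    nonVanishing-w : NonVanishing w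
    nonVanishing-w = nonVanishing λ ω≈0 →
      K.1≉0 (K.trans (K.sym (proj₁ (proj₂ ω-order))) (K.trans (K.*-congʳ ω≈0) (K.zeroˡ _)))

    möbius : RatFun F → RatFun F
    möbius y = ((num y + w * den y) * den y) // (den y * (w * num y + den y))

    ρ≐möbius : ∀ y → ρ F ω y ≐ möbius y
    ρ≐möbius y =
      *-cong (+-congʳ (*-identityʳ (num y))) (trans (*-identityʳ _) (*-identityˡ (den y))) ,
      *-cong (*-identityʳ (den y)) (+-cong (*-identityʳ _) (trans (*-identityˡ _) (*-identityˡ (den y))))

    ρ-cong : ∀ {y y′} → y ∝ y′ → ρ F ω y ∝ ρ F ω y′
    ρ-cong {y} {y′} y∝y′ =
      ∝-trans (≐⇒∝ (ρ≐möbius y)) (∝-trans möbius-∝ (∝-sym (≐⇒∝ (ρ≐möbius y′))))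
      where
      a b n d n′ d′ : Poly F
      a = κ y∝y′; b = κ′ y∝y′; n = num y; d = den y; n′ = num y′; d′ = den y′
      num-lin : a * (n + w * d) ≈ b * (n′ + w * d′)
      num-lin = rescale-+ a b n n′ (w * d) (w * d′)
                          (num-∝ y∝y′) (rescale-scalar a b w d d′ (den-∝ y∝y′))
      den-lin : a * (w * n + d) ≈ b * (w * n′ + d′)
      den-lin = rescale-+ a b (w * n) (w * n′) d d′
                          (rescale-scalar a b w n n′ (num-∝ y∝y′)) (den-∝ y∝y′)
      möbius-∝ : möbius y ∝ möbius y′
      möbius-∝ = record
        { κ = a * a ; κ′ = b * b
        ; κ-nonVanishing = nonVanishing-* (κ-nonVanishing y∝y′) (κ-nonVanishing y∝y′)
        ; κ′-nonVanishing = nonVanishing-* (κ′-nonVanishing y∝y′) (κ′-nonVanishing y∝y′)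
        ; num-∝ = rescale-* a b a b (n + w * d) (n′ + w * d′) d d′ num-lin (den-∝ y∝y′)
        ; den-∝ = rescale-* a b a b d d′ (w * n + d) (w * n′ + d′) (den-∝ y∝y′) den-lin }

    ρ-evaluate : ∀ {G₁ G₂ P₁ P₂} → NonVanishing G₂ → G₁ + w * G₂ ≈ P₁ → w * G₁ + G₂ ≈ P₂ →
                 ρ F ω (G₁ // G₂) ∝ (P₁ // P₂)
    ρ-evaluate {G₁} {G₂} {P₁} {P₂} G₂-nv num≈ den≈ =
      ∝-trans (≐⇒∝ (trans (proj₁ (ρ≐möbius (G₁ // G₂))) (trans (*-congʳ num≈) (*-comm P₁ G₂)) ,
                    trans (proj₂ (ρ≐möbius (G₁ // G₂))) (*-congˡ {G₂} den≈)))
              (∝-sym (∝-rescale G₂ G₂-nv))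

    ρ̂ : Poly F → RatFun F
    ρ̂ A = (A + w) // (w * A + 1#)

    nonVanishing-+w : ∀ A → coeff₀ A K.≈ K.0# → NonVanishing (A + w)
    nonVanishing-+w A A₀≈0 = nonVanishing-vanishing+ A₀≈0 nonVanishing-w

    nonVanishing-w*+1 : ∀ A → coeff₀ A K.≈ K.0# → NonVanishing (w * A + 1#)
    nonVanishing-w*+1 A A₀≈0 = nonVanishing-vanishing+ (vanishing-*ʳ w A A₀≈0) nonVanishing-1

    ρX∝ρ̂X : ρ F ω (Xᵣ F) ∝ ρ̂ X
    ρX∝ρ̂X = ≐⇒∝ (trans (proj₁ (ρ≐möbius (Xᵣ F))) (trans (*-identityʳ _) (+-congˡ {X} (*-identityʳ w))) ,
                  trans (proj₂ (ρ≐möbius (Xᵣ F))) (*-identityˡ _))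

    ρ̂X^[2^n]≐ : ∀ n → let A = X ^ (2 ℕ.^ n); a = w ^ (2 ℕ.^ n) in
                _^ᵣ_ F (ρ̂ X) (+ (2 ℕ.^ n)) ≐ ((A + a) // (a * A + 1#))
    ρ̂X^[2^n]≐ n =
      trans (^ₚ≈^ _ (2 ℕ.^ n)) (frobenius n X w) ,
      trans (^ₚ≈^ _ (2 ℕ.^ n))
            (trans (frobenius n (w * X) 1#) (+-cong (^-distrib-* w X (2 ℕ.^ n)) (1^n≈1 (2 ℕ.^ n))))

    ρ̂X^[2^even] : ∀ n → n % 2 ≡ 0 → _^ᵣ_ F (ρ̂ X) (+ (2 ℕ.^ n)) ∝ ρ̂ (X ^ (2 ℕ.^ n))
    ρ̂X^[2^even] n even with ρ̂X^[2^n]≐ n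
    ... | num≈ , den≈ = ≐⇒∝ (trans num≈ (+-congˡ {X ^ (2 ℕ.^ n)} a≈w) , trans den≈ (+-congʳ (*-congʳ a≈w)))
      where
      a≈w : w ^ (2 ℕ.^ n) ≈ w
      a≈w = w^[2^even]≈w n even

    ρ̂X^[2^odd] : ∀ n → n % 2 ≡ 1 → _^ᵣ_ F (ρ̂ X) (+ (2 ℕ.^ n)) ∝ inv (ρ̂ (X ^ (2 ℕ.^ n)))
    ρ̂X^[2^odd] n odd with ρ̂X^[2^n]≐ n
    ... | num≈ , den≈ = ∝-trans
      (≐⇒∝ (trans num≈ (trans (+-congˡ {A} a≈w²) (sym (w²*[w*x+1]≈x+w² A))) ,
            trans den≈ (trans (+-congʳ (*-congʳ a≈w²)) (sym (w²*[x+w]≈w²*x+1 A)))))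
      (∝-sym (∝-rescale (w * w) (nonVanishing-* nonVanishing-w nonVanishing-w)))
      where
      A : Poly F
      A = X ^ (2 ℕ.^ n)
      a≈w² : w ^ (2 ℕ.^ n) ≈ w * w
      a≈w² = w^[2^odd]≈w² n odd

    ρ-of-ρX^[R-Q] : ∀ Q R {a b} → _^ᵣ_ F (ρ̂ X) (+ Q) ∝ a → _^ᵣ_ F (ρ̂ X) (+ R) ∝ b →
                    ρ F ω (_^ᵣ_ F (ρ F ω (Xᵣ F)) (+ R ℤ.- + Q)) ∝ ρ F ω (_/ᵣ_ F b a)
    ρ-of-ρX^[R-Q] Q R ρ̂X^Q∝a ρ̂X^R∝b rewrite [+m]-[+n]≡m⊖n R Q =
      ρ-cong (∝-trans (^ᵣ-cong-ℤ (R ⊖ Q) ρX∝ρ̂X)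
                      (∝-trans (^ᵣ-homo-⊖ (nonVanishing-+w X K.refl) (nonVanishing-w*+1 X K.refl) R Q)
                               (/ᵣ-cong ρ̂X^R∝b ρ̂X^Q∝a)))

    ρ-of-ρX^[R+Q] : ∀ Q R {a b} → _^ᵣ_ F (ρ̂ X) (+ Q) ∝ a → _^ᵣ_ F (ρ̂ X) (+ R) ∝ b →
                    ρ F ω (_^ᵣ_ F (ρ F ω (Xᵣ F)) (+ R ℤ.+ + Q)) ∝ ρ F ω (_*ᵣ_ F b a)
    ρ-of-ρX^[R+Q] Q R ρ̂X^Q∝a ρ̂X^R∝b =
      ρ-cong (∝-trans (^ᵣ-cong (R ℕ.+ Q) ρX∝ρ̂X)
                      (∝-trans (^ᵣ-homo-+ (ρ̂ X) R Q) (*ᵣ-cong ρ̂X^R∝b ρ̂X^Q∝a)))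

    module Exponents (ℓ m : ℕ) where

      private
        A B G₁ G₂ : Poly F
        A = X ^ (2 ℕ.^ ℓ)
        B = X ^ (2 ℕ.^ m)
        G₁ = (B + w) * (w * A + 1#)
        G₂ = (w * B + 1#) * (A + w)

        A₀≈0 : coeff₀ A K.≈ K.0#
        A₀≈0 = vanishing-X^ (2 ℕ.^ ℓ) {{ℕ.m^n≢0 2 ℓ}}
        B₀≈0 : coeff₀ B K.≈ K.0#
        B₀≈0 = vanishing-X^ (2 ℕ.^ m) {{ℕ.m^n≢0 2 m}}

        nonVanishing-+1 : ∀ C → coeff₀ C K.≈ K.0# → NonVanishing (A * B + C + 1#)
        nonVanishing-+1 C C₀≈0 =
          nonVanishing-vanishing+ (vanishing-+ (A * B) C (vanishing-*ʳ A B B₀≈0) C₀≈0) nonVanishing-1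

      ρ-quotient-≈ᵣ : ∀ {f g} → f ∝ fracₚ A B → g ∝ ρ F ω (_/ᵣ_ F (ρ̂ B) (ρ̂ A)) → _≈ᵣ_ F f g
      ρ-quotient-≈ᵣ f∝ g∝ = ∝⇒≈ᵣ f∝ (∝-trans g∝ ρ[B/A]∝frac) (nonVanishing-+1 B B₀≈0)
        where
        ρ[B/A]∝frac : ρ F ω (_/ᵣ_ F (ρ̂ B) (ρ̂ A)) ∝ fracₚ A B
        ρ[B/A]∝frac = ρ-evaluate (nonVanishing-* (nonVanishing-w*+1 B B₀≈0) (nonVanishing-+w A A₀≈0))
                                 (möbius-quotient-num A B) (möbius-quotient-den A B)

      ρ-quotient⁻¹-≈ᵣ : ∀ {f g} → f ∝ inv (fracₚ A B) → g ∝ ρ F ω (inv (_/ᵣ_ F (ρ̂ B) (ρ̂ A))) →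
                        _≈ᵣ_ F f g
      ρ-quotient⁻¹-≈ᵣ f∝ g∝ = ∝⇒≈ᵣ f∝ (∝-trans g∝ ρ[A/B]∝frac⁻¹) (nonVanishing-+1 A A₀≈0)
        where
        ρ[A/B]∝frac⁻¹ : ρ F ω (inv (_/ᵣ_ F (ρ̂ B) (ρ̂ A))) ∝ inv (fracₚ A B)
        ρ[A/B]∝frac⁻¹ = ρ-evaluate (nonVanishing-* (nonVanishing-+w B B₀≈0) (nonVanishing-w*+1 A A₀≈0))
                                   (trans (+-comm G₂ (w * G₁)) (möbius-quotient-den A B))
                                   (trans (+-comm (w * G₂) G₁) (möbius-quotient-num A B))

open import Data.Nat using (_^_; _%_)

lemma2p4 : ∀ {c ℓ' : Level} (F : Field c ℓ') (k ℓ m : ℕ)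
    → 0 ℕ.< k → 0 ℕ.< ℓ → 0 ℕ.< m → ℓ ≢ m
    → HasCard F ((2 ^ k) ℕ.* (2 ^ k))
    → (ω : Field.Carrier F) → HasOrder F ω 3
    → ((ℓ % 2 ≡ m % 2)
         → _≈ᵣ_ F (_^ᵣ_ F (frac F (2 ^ ℓ) (2 ^ m)) (ℤ._^_ -1ℤ m))
                  (ρ F ω (_^ᵣ_ F (ρ F ω (Xᵣ F)) (+ (2 ^ m) ℤ.- + (2 ^ ℓ)))))
    × (¬ (ℓ % 2 ≡ m % 2)
         → _≈ᵣ_ F (_^ᵣ_ F (frac F (2 ^ ℓ) (2 ^ m)) (ℤ._^_ -1ℤ m))
                  (ρ F ω (_^ᵣ_ F (ρ F ω (Xᵣ F)) (+ (2 ^ m) ℤ.+ + (2 ^ ℓ)))))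
lemma2p4 F k ℓ m _ _ _ _ card ω ω-order = by-parity (n%2≡0⊎n%2≡1 ℓ) (n%2≡0⊎n%2≡1 m)
  where
  open RationalFunctions F
  open Möbius (FieldProperties.characteristic-two F k card) ω-order
  Q R : ℕ
  Q = 2 ^ ℓ
  R = 2 ^ m
  open Exponents ℓ m
  lhs : RatFun F
  lhs = _^ᵣ_ F (frac F Q R) (ℤ._^_ -1ℤ m)
  ρρX^ : ℤ → RatFun F
  ρρX^ i = ρ F ω (_^ᵣ_ F (ρ F ω (Xᵣ F)) i)
  by-parity : ℓ % 2 ≡ 0 ⊎ ℓ % 2 ≡ 1 → m % 2 ≡ 0 ⊎ m % 2 ≡ 1
            → (ℓ % 2 ≡ m % 2 → _≈ᵣ_ F lhs (ρρX^ (+ R ℤ.- + Q)))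
            × (¬ (ℓ % 2 ≡ m % 2) → _≈ᵣ_ F lhs (ρρX^ (+ R ℤ.+ + Q)))
  by-parity (inj₁ ℓ₀) (inj₁ m₀) =
    (λ _ → ρ-quotient-≈ᵣ (frac^[-1^even] Q R m m₀)
                         (ρ-of-ρX^[R-Q] Q R (ρ̂X^[2^even] ℓ ℓ₀) (ρ̂X^[2^even] m m₀))) ,
    (λ ℓ≢m → ⊥-elim (ℓ≢m (≡.trans ℓ₀ (≡.sym m₀))))
  by-parity (inj₂ ℓ₁) (inj₂ m₁) =
    (λ _ → ρ-quotient⁻¹-≈ᵣ (frac^[-1^odd] Q R m m₁)
                           (ρ-of-ρX^[R-Q] Q R (ρ̂X^[2^odd] ℓ ℓ₁) (ρ̂X^[2^odd] m m₁))) ,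
    (λ ℓ≢m → ⊥-elim (ℓ≢m (≡.trans ℓ₁ (≡.sym m₁))))
  by-parity (inj₂ ℓ₁) (inj₁ m₀) =
    (λ ℓ≡m → ⊥-elim (ℕ.0≢1+n (≡.trans (≡.sym m₀) (≡.trans (≡.sym ℓ≡m) ℓ₁)))) ,
    (λ _ → ρ-quotient-≈ᵣ (frac^[-1^even] Q R m m₀)
                         (ρ-of-ρX^[R+Q] Q R (ρ̂X^[2^odd] ℓ ℓ₁) (ρ̂X^[2^even] m m₀)))
  by-parity (inj₁ ℓ₀) (inj₂ m₁) =
    (λ ℓ≡m → ⊥-elim (ℕ.0≢1+n (≡.trans (≡.sym ℓ₀) (≡.trans ℓ≡m m₁)))) ,
    (λ _ → ρ-quotient⁻¹-≈ᵣ (frac^[-1^odd] Q R m m₁)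
                           (ρ-of-ρX^[R+Q] Q R (ρ̂X^[2^even] ℓ ℓ₀) (ρ̂X^[2^odd] m m₁)))
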